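{- For integers $n\geq 2$ and $0\leq k<n/2$, $$\binom{6k}{3k}\binom{3k}{k}\binom{6(n-k)}{3(n-k)}\binom{3(n-k)}{n-k}\geq \binom{6k+6}{3k+3}\binom{3k+3}{k+1}\binom{6(n-k-1)}{3(n-k-1)}\binom{3(n-k-1)}{n-k-1},$$ and consequently, for $n\geq 2$, $$\frac{2}{2n-1}\binom{6n}{3n}\leq s_n\leq \frac{n+1}{2n-1}\binom{6n}{3n},$$ where $$s_n:=\frac{1}{(2n-1)\binom{3n}{n}}\sum_{k=0}^{n}\binom{6k}{3k}\binom{3k}{k}\binom{6(n-k)}{3(n-k)}\binom{3(n-k)}{n-k}.$$ -}

module Defs where

open import Data.Nat
open import Data.Nat.Properties
open import Data.Nat.Combinatorics using (_C_; nCk+nC[k+1]≡[n+1]C[k+1])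
open import Data.List using (List; map; upTo)
open import Data.Nat.ListAction using (sum)
open import Data.Integer using (+_)
open import Data.Rational using (ℚ) renaming (_/_ to _/ℚ_)
open import Relation.Binary.PropositionalEquality

a : ℕ → ℕ
a k = ((6 * k) C (3 * k)) * ((3 * k) C k)

term : ℕ → ℕ → ℕ
term n k = a k * a (n ∸ k)

sumTerms : ℕ → ℕ
sumTerms n = sum (map (term n) (upTo (suc n)))

C-pos : ∀ n k → k ≤ n → 0 < n C k
C-pos n zero _ = s≤s z≤n
C-pos (suc n) (suc k) (s≤s k≤n) =
  subst (0 <_) (nCk+nC[k+1]≡[n+1]C[k+1] n k)
    (<-≤-trans (C-pos n k k≤n) (m≤m+n (n C k) (n C suc k)))

denom : ℕ → ℕ
denom n = (2 * n ∸ 1) * ((3 * n) C n)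

denom-nonZero : ∀ m → NonZero (denom (suc (suc m)))
denom-nonZero m = >-nonZero (*-pos {2 * n ∸ 1} {(3 * n) C n} (s≤s z≤n) (C-pos (3 * n) n (m≤n*m n 3)))
  where n = suc (suc m)
        *-pos : ∀ {x y} → 0 < x → 0 < y → 0 < x * y
        *-pos {suc x} {suc y} _ _ = s≤s z≤n

-- s_n for n = m + 2 (the statement only concerns n ≥ 2)
s : (m : ℕ) → ℚ
s m = (+ sumTerms (suc (suc m)) /ℚ denom (suc (suc m))) {{denom-nonZero m}}

-- The whole argument rests on the ratio of consecutive terms:
--   a(k+1) / a(k) = (6k+6)!·(3k)!·k!·(2k)! / ((6k)!·(3k+3)!·(k+1)!·(2k+2)!)
--                 = 12(6k+1)(6k+5) / (k+1)²,
-- which is nonincreasing in k.  A sequence whose ratio of consecutive terms is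
-- nonincreasing is log-concave, and a log-concave sequence satisfies
--   a(i)·a(j) ≤ a(0)·a(i+j).
-- The summands T(n,k) = a(k)·a(n-k) therefore decrease on the first half of
-- the range (part one of the theorem) and are all bounded by T(n,0) = a(n).
-- Hence 2·a(n) = T(n,0) + T(n,n) ≤ Σ_k T(n,k) ≤ (n+1)·a(n), and dividing by
-- (2n-1)·C(3n,n), using a(n) = C(6n,3n)·C(3n,n), gives the bounds on s_n.
module Submission where

open import Defs
open import Data.Nat using (ℕ; zero; suc; _+_; _*_; _∸_; _≤_; _<_; _≥_; _!; z≤n; s≤s; NonZero)
open import Data.Nat.Properties
open import Data.Nat.Combinatorics using (_C_; k![n∸k]!∣n!)
open import Data.Nat.Combinatorics.Specification using (nCk≡n!/k![n-k]!)
open import Data.Nat.DivMod using (m/n*n≡m)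
open import Data.Nat.Tactic.RingSolver using (solve-∀)
open import Data.Nat.ListAction using (sum)
open import Data.Nat.ListAction.Properties using (sum-++)
open import Data.List using (map; upTo; [_]; _++_)
open import Data.List.Properties using (upTo-∷ʳ; map-++)
open import Data.Integer as ℤ using (+_; +≤+)
open import Data.Integer.Properties using (pos-*)
open import Data.Rational using (toℚᵘ) renaming (_/_ to _/ℚ_; _*_ to _*ℚ_; _≤_ to _≤ℚ_)
open import Data.Rational.Properties using (toℚᵘ-fromℚᵘ; toℚᵘ-homo-*; toℚᵘ-cancel-≤; toℚᵘ-injective; /-cong)
open import Data.Rational.Unnormalised as ℚᵘ using (_≃_; *≤*)
import Data.Rational.Unnormalised.Properties as ℚᵘP
open import Data.Product using (_×_; _,_)
open import Data.Sum using (inj₁; inj₂)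
open import Relation.Binary.PropositionalEquality hiding ([_])

binomial-factorials : ∀ {n} k m → k + m ≡ n → (n C k) * (k ! * m !) ≡ n !
binomial-factorials k m refl =
  trans (cong (λ r → ((k + m) C k) * (k ! * r !)) (sym (m+n∸m≡n k m)))
        (trans (cong (_* (k ! * (k + m ∸ k) !)) (nCk≡n!/k![n-k]! k≤k+m))
               (m/n*n≡m {{k !* (k + m ∸ k) !≢0}} (k![n∸k]!∣n! k≤k+m)))
  where k≤k+m = m≤m+n k m

-- The denominator of a(k) = (6k)! / ((3k)!·k!·(2k)!).
D : ℕ → ℕ
D k = (3 * k) ! * (k ! * (2 * k) !)

a-factorials : ∀ k → a k * D k ≡ (6 * k) !
a-factorials k = begin
  a k * D k                                    ≡⟨ regroup c₆ c₃ ((3 * k) !) (k ! * (2 * k) !) ⟩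
  c₆ * ((3 * k) ! * (c₃ * (k ! * (2 * k) !)))  ≡⟨ cong (λ x → c₆ * ((3 * k) ! * x)) (binomial-factorials k (2 * k) (k+2k≡3k k)) ⟩
  c₆ * ((3 * k) ! * (3 * k) !)                 ≡⟨ binomial-factorials (3 * k) (3 * k) (3k+3k≡6k k) ⟩
  (6 * k) !                                    ∎
  where
  open ≡-Reasoning
  c₆ = (6 * k) C (3 * k)
  c₃ = (3 * k) C k
  regroup : ∀ x y u v → x * y * (u * v) ≡ x * (u * (y * v))
  regroup = solve-∀
  k+2k≡3k : ∀ i → i + 2 * i ≡ 3 * i
  k+2k≡3k = solve-∀
  3k+3k≡6k : ∀ i → 3 * i + 3 * i ≡ 6 * i
  3k+3k≡6k = solve-∀

F : ℕ → ℕ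
F k = (6 + 6 * k) * ((5 + 6 * k) * ((4 + 6 * k) * ((3 + 6 * k) * ((2 + 6 * k) * (1 + 6 * k)))))

G : ℕ → ℕ
G k = (3 + 3 * k) * ((2 + 3 * k) * ((1 + 3 * k) * ((1 + k) * ((2 + 2 * k) * (1 + 2 * k)))))

[6k+6]! : ∀ k → (6 * suc k) ! ≡ F k * (6 * k) !
[6k+6]! k = trans (cong _! (*-suc 6 k)) (regroup k ((6 * k) !))
  where
  regroup : ∀ i X → (6 + 6 * i) * ((5 + 6 * i) * ((4 + 6 * i) * ((3 + 6 * i) * ((2 + 6 * i) * ((1 + 6 * i) * X)))))
                    ≡ ((6 + 6 * i) * ((5 + 6 * i) * ((4 + 6 * i) * ((3 + 6 * i) * ((2 + 6 * i) * (1 + 6 * i)))))) * X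
  regroup = solve-∀

D-step : ∀ k → D (suc k) ≡ G k * D k
D-step k = trans (cong₂ (λ u v → u ! * (suc k ! * v !)) (*-suc 3 k) (*-suc 2 k))
                 (regroup k ((3 * k) !) (k !) ((2 * k) !))
  where
  regroup : ∀ i x y z → ((3 + 3 * i) * ((2 + 3 * i) * ((1 + 3 * i) * x))) * ((1 + i) * y * ((2 + 2 * i) * ((1 + 2 * i) * z)))
                        ≡ ((3 + 3 * i) * ((2 + 3 * i) * ((1 + 3 * i) * ((1 + i) * ((2 + 2 * i) * (1 + 2 * i)))))) * (x * (y * z))
  regroup = solve-∀

P : ℕ → ℕ
P k = 12 * ((1 + 6 * k) * (5 + 6 * k))

Q : ℕ → ℕ
Q k = suc k * suc k

a-ratio : ∀ k → a (suc k) * Q k ≡ P k * a k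
a-ratio k = *-cancelʳ-≡ _ _ (D (suc k)) {{D≢0}} (begin
  a (suc k) * Q k * D (suc k)    ≡⟨ swap (a (suc k)) (Q k) (D (suc k)) ⟩
  Q k * (a (suc k) * D (suc k))  ≡⟨ cong (Q k *_) (trans (a-factorials (suc k)) ([6k+6]! k)) ⟩
  Q k * (F k * (6 * k) !)        ≡⟨ cong (λ x → Q k * (F k * x)) (sym (a-factorials k)) ⟩
  Q k * (F k * (a k * D k))      ≡⟨ F·Q≡G·P k (a k) (D k) ⟩
  P k * a k * (G k * D k)        ≡⟨ cong (P k * a k *_) (sym (D-step k)) ⟩
  P k * a k * D (suc k)          ∎)
  where
  open ≡-Reasoning
  D≢0 : NonZero (D (suc k))
  D≢0 = m*n≢0 _ _ {{(3 * suc k) !≢0}} {{suc k !* (2 * suc k) !≢0}}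
  swap : ∀ x y z → x * y * z ≡ y * (x * z)
  swap = solve-∀
  F·Q≡G·P : ∀ i x y →
    (suc i * suc i) * (((6 + 6 * i) * ((5 + 6 * i) * ((4 + 6 * i) * ((3 + 6 * i) * ((2 + 6 * i) * (1 + 6 * i)))))) * (x * y))
    ≡ 12 * ((1 + 6 * i) * (5 + 6 * i)) * x * (((3 + 3 * i) * ((2 + 3 * i) * ((1 + 3 * i) * ((1 + i) * ((2 + 2 * i) * (1 + 2 * i)))))) * y)
  F·Q≡G·P = solve-∀

ratio-nonincreasing : ∀ {k j} → k ≤ j → P k * Q j ≤ P j * Q k
ratio-nonincreasing {k} {j} k≤j = subst (λ j → P k * Q j ≤ P j * Q k) (m+[n∸m]≡n k≤j)
  (subst (P k * Q (k + (j ∸ k)) ≤_) (sym (expand k (j ∸ k))) (m≤m+n _ _))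
  where
  -- with j = k + d, the difference P j · Q k − P k · Q j is a polynomial with nonnegative coefficients
  expand : ∀ i d → (12 * ((1 + 6 * (i + d)) * (5 + 6 * (i + d)))) * ((1 + i) * (1 + i))
      ≡ (12 * ((1 + 6 * i) * (5 + 6 * i))) * ((1 + (i + d)) * (1 + (i + d)))
        + 12 * (d * (1 + i) * (26 + 36 * i) + d * d * (31 + 36 * i))
  expand = solve-∀

LogConcave : (ℕ → ℕ) → Set
LogConcave f = ∀ {k j} → k ≤ j → f (suc k) * f j ≤ f k * f (suc j)

ratio-nonincreasing⇒log-concave : ∀ (f p q : ℕ → ℕ) → (∀ k → NonZero (q k)) →
  (∀ k → f (suc k) * q k ≡ p k * f k) →
  (∀ {k j} → k ≤ j → p k * q j ≤ p j * q k) →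
  LogConcave f
ratio-nonincreasing⇒log-concave f p q q≢0 step mono {k} {j} k≤j =
  *-cancelʳ-≤ _ _ (q k * q j) {{m*n≢0 _ _ {{q≢0 k}} {{q≢0 j}}}} (begin
    f (suc k) * f j * (q k * q j)    ≡⟨ regroup (f (suc k)) (f j) (q k) (q j) ⟩
    (f (suc k) * q k) * (f j * q j)  ≡⟨ cong (_* (f j * q j)) (step k) ⟩
    (p k * f k) * (f j * q j)        ≡⟨ regroup′ (p k) (f k) (f j) (q j) ⟩
    (f k * f j) * (p k * q j)        ≤⟨ *-monoʳ-≤ (f k * f j) (mono k≤j) ⟩
    (f k * f j) * (p j * q k)        ≡⟨ regroup″ (f k) (f j) (p j) (q k) ⟩
    f k * (p j * f j) * q k          ≡⟨ cong (λ x → f k * x * q k) (sym (step j)) ⟩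
    f k * (f (suc j) * q j) * q k    ≡⟨ regroup‴ (f k) (f (suc j)) (q j) (q k) ⟩
    f k * f (suc j) * (q k * q j)    ∎)
  where
  open ≤-Reasoning
  regroup : ∀ x y u v → x * y * (u * v) ≡ (x * u) * (y * v)
  regroup = solve-∀
  regroup′ : ∀ u x y v → (u * x) * (y * v) ≡ (x * y) * (u * v)
  regroup′ = solve-∀
  regroup″ : ∀ x y u v → (x * y) * (u * v) ≡ x * (u * y) * v
  regroup″ = solve-∀
  regroup‴ : ∀ x y u v → x * (y * u) * v ≡ x * y * (v * u)
  regroup‴ = solve-∀

a-log-concave : LogConcave a
a-log-concave = ratio-nonincreasing⇒log-concave a P Q (λ _ → _) a-ratio ratio-nonincreasing

-- In a log-concave sequence, splitting an index lowers the product: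
-- f(i)·f(j) ≤ f(0)·f(i+j).  For i ≤ j, move one unit from i to j at a time.
split-≤-ordered : ∀ f → LogConcave f → ∀ i j → i ≤ j → f i * f j ≤ f 0 * f (i + j)
split-≤-ordered f lc zero    j _   = ≤-refl
split-≤-ordered f lc (suc i) j i<j = begin
  f (suc i) * f j     ≤⟨ lc (<⇒≤ i<j) ⟩
  f i * f (suc j)     ≤⟨ split-≤-ordered f lc i (suc j) (≤-trans (<⇒≤ i<j) (n≤1+n j)) ⟩
  f 0 * f (i + suc j) ≡⟨ cong (λ x → f 0 * f x) (+-suc i j) ⟩
  f 0 * f (suc i + j) ∎
  where open ≤-Reasoning

split-≤ : ∀ f → LogConcave f → ∀ i j → f i * f j ≤ f 0 * f (i + j)
split-≤ f lc i j with ≤-total i j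
... | inj₁ i≤j = split-≤-ordered f lc i j i≤j
... | inj₂ j≤i = subst₂ (λ x y → x ≤ f 0 * f y) (*-comm (f j) (f i)) (+-comm j i)
                        (split-≤-ordered f lc j i j≤i)

-- Part one of the theorem: T(n,k+1) ≤ T(n,k) while 2k < n, since then k ≤ n-k-1.
summands-decrease : ∀ n k → 2 * k < n → term n (suc k) ≤ term n k
summands-decrease n k 2k<n =
  subst (λ x → a (suc k) * a (n ∸ suc k) ≤ a k * a x) (sym (+-∸-assoc 1 k<n))
        (a-log-concave (m+n≤o⇒m≤o∸n k (subst (_≤ n) (sym (k+[1+k]≡1+2k k)) 2k<n)))
  where
  k<n : k < n
  k<n = ≤-trans (s≤s (m≤n*m k 2)) 2k<n
  k+[1+k]≡1+2k : ∀ i → i + suc i ≡ suc (2 * i)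
  k+[1+k]≡1+2k = solve-∀

summand-≤-end : ∀ n i → i ≤ n → term n i ≤ term n 0
summand-≤-end n i i≤n =
  subst (λ x → term n i ≤ a 0 * a x) (m+[n∸m]≡n i≤n) (split-≤ a a-log-concave i (n ∸ i))

term-first : ∀ n → term n 0 ≡ a n
term-first n = +-identityʳ (a n)

term-last : ∀ n → term n n ≡ a n
term-last n = trans (cong (λ x → a n * a x) (n∸n≡0 n)) (*-identityʳ (a n))

sumUpTo : (ℕ → ℕ) → ℕ → ℕ
sumUpTo f L = sum (map f (upTo L))

sumUpTo-suc : ∀ f L → sumUpTo f (suc L) ≡ sumUpTo f L + f L
sumUpTo-suc f L = begin
  sum (map f (upTo (suc L)))       ≡⟨ cong (λ xs → sum (map f xs)) (sym (upTo-∷ʳ L)) ⟩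
  sum (map f (upTo L ++ [ L ]))    ≡⟨ cong sum (map-++ f (upTo L) [ L ]) ⟩
  sum (map f (upTo L) ++ [ f L ])  ≡⟨ sum-++ (map f (upTo L)) [ f L ] ⟩
  sumUpTo f L + (f L + 0)          ≡⟨ cong (_+_ (sumUpTo f L)) (+-identityʳ (f L)) ⟩
  sumUpTo f L + f L                ∎
  where open ≡-Reasoning

sumUpTo-≤ : ∀ f b L → (∀ i → i < L → f i ≤ b) → sumUpTo f L ≤ L * b
sumUpTo-≤ f b zero    _     = z≤n
sumUpTo-≤ f b (suc L) f≤b = begin
  sumUpTo f (suc L)  ≡⟨ sumUpTo-suc f L ⟩
  sumUpTo f L + f L  ≤⟨ +-mono-≤ (sumUpTo-≤ f b L (λ i i<L → f≤b i (m≤n⇒m≤1+n i<L))) (f≤b L ≤-refl) ⟩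
  L * b + b          ≡⟨ +-comm (L * b) b ⟩
  suc L * b          ∎
  where open ≤-Reasoning

sumUpTo-ends : ∀ f n → f 0 + f (suc n) ≤ sumUpTo f (suc (suc n))
sumUpTo-ends f n = subst (f 0 + f (suc n) ≤_) (sym (sumUpTo-suc f (suc n)))
                         (+-monoˡ-≤ (f (suc n)) (m≤m+n (f 0) _))

sumTerms-upper : ∀ n → sumTerms n ≤ suc n * a n
sumTerms-upper n = subst (λ x → sumTerms n ≤ suc n * x) (term-first n)
  (sumUpTo-≤ (term n) (term n 0) (suc n) (λ i i<1+n → summand-≤-end n i (≤-pred i<1+n)))

sumTerms-lower : ∀ n → 2 * a (suc n) ≤ sumTerms (suc n)
sumTerms-lower n = begin
  2 * a (suc n)                         ≡⟨ cong (_+_ (a (suc n))) (+-identityʳ (a (suc n))) ⟩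
  a (suc n) + a (suc n)                 ≡⟨ sym (cong₂ _+_ (term-first (suc n)) (term-last (suc n))) ⟩
  term (suc n) 0 + term (suc n) (suc n) ≤⟨ sumUpTo-ends (term (suc n)) n ⟩
  sumTerms (suc n)                      ∎
  where open ≤-Reasoning

toℚᵘ-/ : ∀ i d .{{_ : NonZero d}} → toℚᵘ (+ i /ℚ d) ≃ + i ℚᵘ./ d
toℚᵘ-/ i (suc d) = toℚᵘ-fromℚᵘ (+ i ℚᵘ./ suc d)

/-mono-≤ : ∀ i j b d .{{_ : NonZero b}} .{{_ : NonZero d}} → i * d ≤ j * b → + i /ℚ b ≤ℚ + j /ℚ d
/-mono-≤ i j b@(suc _) d@(suc _) i*d≤j*b = toℚᵘ-cancel-≤
  (ℚᵘP.≤-respˡ-≃ (ℚᵘP.≃-sym (toℚᵘ-/ i b)) (ℚᵘP.≤-respʳ-≃ (ℚᵘP.≃-sym (toℚᵘ-/ j d))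
    (*≤* (subst₂ ℤ._≤_ (pos-* i d) (pos-* j b) (+≤+ i*d≤j*b)))))

/-* : ∀ i j b d .{{_ : NonZero b}} .{{_ : NonZero d}} →
      (+ i /ℚ b) *ℚ (+ j /ℚ d) ≡ (+ (i * j) /ℚ (b * d)) {{m*n≢0 b d}}
/-* i j b@(suc _) d@(suc _) = toℚᵘ-injective (begin
  toℚᵘ ((+ i /ℚ b) *ℚ (+ j /ℚ d))        ≈⟨ toℚᵘ-homo-* (+ i /ℚ b) (+ j /ℚ d) ⟩
  toℚᵘ (+ i /ℚ b) ℚᵘ.* toℚᵘ (+ j /ℚ d)   ≈⟨ ℚᵘP.*-cong (toℚᵘ-/ i b) (toℚᵘ-/ j d) ⟩
  (+ i ℚᵘ./ b) ℚᵘ.* (+ j ℚᵘ./ d)         ≡⟨ cong (ℚᵘ._/ (b * d)) (sym (pos-* i j)) ⟩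
  + (i * j) ℚᵘ./ (b * d)                 ≈⟨ ℚᵘP.≃-sym (toℚᵘ-/ (i * j) (b * d)) ⟩
  toℚᵘ (+ (i * j) /ℚ (b * d))            ∎)
  where open ℚᵘP.≃-Reasoning

/-*-integer : ∀ i j b .{{_ : NonZero b}} → (+ i /ℚ b) *ℚ (+ j /ℚ 1) ≡ + (i * j) /ℚ b
/-*-integer i j b@(suc _) = trans (/-* i j b 1) (/-cong {+ (i * j)} refl (*-identityʳ b))

cancel-N : ∀ p c b N → p * c * (N * b) ≡ p * (c * b) * N
cancel-N = solve-∀

scaled-≤ : ∀ p c b S N .{{_ : NonZero N}} .{{_ : NonZero (N * b)}} → p * (c * b) ≤ S →
           (+ p /ℚ N) *ℚ (+ c /ℚ 1) ≤ℚ + S /ℚ (N * b)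
scaled-≤ p c b S N p·cb≤S = subst (_≤ℚ + S /ℚ (N * b)) (sym (/-*-integer p c N))
  (/-mono-≤ (p * c) S N (N * b) (begin
    p * c * (N * b)  ≡⟨ cancel-N p c b N ⟩
    p * (c * b) * N  ≤⟨ *-monoˡ-≤ N p·cb≤S ⟩
    S * N            ∎))
  where open ≤-Reasoning

scaled-≥ : ∀ p c b S N .{{_ : NonZero N}} .{{_ : NonZero (N * b)}} → S ≤ p * (c * b) →
           + S /ℚ (N * b) ≤ℚ (+ p /ℚ N) *ℚ (+ c /ℚ 1)
scaled-≥ p c b S N S≤p·cb = subst (+ S /ℚ (N * b) ≤ℚ_) (sym (/-*-integer p c N))
  (/-mono-≤ S (p * c) (N * b) N (begin
    S * N            ≤⟨ *-monoˡ-≤ N S≤p·cb ⟩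
    p * (c * b) * N  ≡⟨ cancel-N p c b N ⟨
    p * c * (N * b)  ∎))
  where open ≤-Reasoning

theorem2 : ((n k : ℕ) → 2 ≤ n → 2 * k < n → term n k ≥ term n (suc k))
    × ((m : ℕ) →
        ((+ 2 /ℚ (2 * (suc (suc m)) ∸ 1)) *ℚ (+ ((6 * (suc (suc m))) C (3 * (suc (suc m)))) /ℚ 1) ≤ℚ s m)
        × (s m ≤ℚ (+ (suc (suc (suc m))) /ℚ (2 * (suc (suc m)) ∸ 1)) *ℚ (+ ((6 * (suc (suc m))) C (3 * (suc (suc m)))) /ℚ 1)))
theorem2 = (λ n k _ → summands-decrease n k) , λ m → lower m , upper m
  where
  -- s m = S/(N·b) and a(n) = c·b, where n = m + 2
  N c b S : ℕ → ℕ
  N m = 2 * suc (suc m) ∸ 1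
  c m = (6 * suc (suc m)) C (3 * suc (suc m))
  b m = (3 * suc (suc m)) C suc (suc m)
  S m = sumTerms (suc (suc m))

  lower : ∀ m → (+ 2 /ℚ N m) *ℚ (+ c m /ℚ 1) ≤ℚ s m
  lower m = scaled-≤ 2 (c m) (b m) (S m) (N m) {{_}} {{denom-nonZero m}} (sumTerms-lower (suc m))

  upper : ∀ m → s m ≤ℚ (+ suc (suc (suc m)) /ℚ N m) *ℚ (+ c m /ℚ 1)
  upper m = scaled-≥ (suc (suc (suc m))) (c m) (b m) (S m) (N m) {{_}} {{denom-nonZero m}}
                     (sumTerms-upper (suc (suc m)))
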